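{- In the Warden's Game with position set $\mathbf{S}$ and goal $\alpha$, for every nonnegative integer $m$ there is at most one position $\beta\in\mathbf{S}$ with $r(\beta)=m$.
   Context: $\mathbf{T}(n,k)$ is the set of strings of length $n$ over $\{1,\ldots,k\}$; $\mathbf{S}\subseteq\mathbf{T}(n,k)$ is closed under rotations (cyclic shifts), and $\alpha\in\mathbf{S}$. Warden's Game: positions are elements of $\mathbf{S}$. From a position $\gamma c$ ($\gamma$ of length $n-1$, $c$ the last symbol), the warden may either move to $c'\gamma$ for some symbol $c'<c$ with $c'\gamma\in\mathbf{S}$, or pass; if he passes, the prisoner must move to $c'\gamma$ for some symbol $c'\ge c$ with $c'\gamma\in\mathbf{S}$. The game ends (prisoner wins) as soon as the position equals $\alpha$ after some move. Remoteness: for $\beta\in\mathbf{S}$, $r(\beta)$ is the number of moves the game lasts starting from $\beta$ when both players play optimally (the prisoner minimizing and the warden maximizing the number of moves until $\alpha$ is reached after a move); $r(\beta)=\infty$ if the warden can prevent $\alpha$ from ever being reached. In particular $r(\alpha)\ge1$, as $\alpha$ is treated as a starting position. -}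

module Defs where

open import Data.Nat using (ℕ; zero; suc)
open import Data.Fin using (Fin; _<_; _≤_)
open import Data.Vec using (Vec; []; _∷_; _∷ʳ_; init; last)
open import Data.Product using (Σ; _×_; ∃)
open import Data.Sum using (_⊎_)
open import Data.Empty using (⊥)
open import Relation.Binary.PropositionalEquality using (_≡_)
open import Relation.Unary using (Pred)
open import Level using (0ℓ)

-- Strings of length n over an alphabet with k ordered symbols
-- (symbols 1..k are represented by Fin k, with its usual order).
T : ℕ → ℕ → Set
T n k = Vec (Fin k) n

-- One-step cyclic shift (left rotation); every rotation is an iterate of it.
rotate : ∀ {A : Set} {n} → Vec A n → Vec A n
rotate []       = []
rotate (x ∷ xs) = xs ∷ʳ x

RotationClosed : ∀ {n k} → Pred (T n k) 0ℓ → Set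
RotationClosed {n} {k} S = ∀ (v : T n k) → S v → S (rotate v)

-- Warden's game on positions of length suc n, position set S, goal α.
-- A position β = γ c (γ = init β, c = last β) moves to c' γ = c' ∷ init β.
module WardensGame {n k : ℕ} (S : Pred (T (suc n) k) 0ℓ) (α : T (suc n) k) where

  mutual
    -- Forces t β : starting from β, the prisoner can force the position
    -- to equal α after some move, within at most t moves, against any
    -- warden strategy.
    Forces : ℕ → T (suc n) k → Set
    Forces zero    β = ⊥
    Forces (suc t) β =
      (∀ (c' : Fin k) → c' < last β → S (c' ∷ init β) → Good t (c' ∷ init β))
      -- and if the warden passes, the prisoner has a good move c' ≥ c
      × (∃ λ (c' : Fin k) → last β ≤ c' × S (c' ∷ init β) × Good t (c' ∷ init β))

    Good : ℕ → T (suc n) k → Set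
    Good t γ = γ ≡ α ⊎ Forces t γ

  Remoteness : T (suc n) k → ℕ → Set
  Remoteness β m = Forces m β × (∀ t → t Data.Nat.< m → Forces t β → ⊥)

-- A position of remoteness m + 1 has a move to a
-- position of remoteness m (the prisoner's best move, or else a warden move
-- that is exactly as slow), so by induction two such positions share their
-- prefix γ and differ only in their last symbols c < c'.  Every warden move
-- from γ c' and the prisoner's reply e > c from γ c' are then moves from γ c
-- as well.  As at most one move from γ has remoteness m, optimality at γ c
-- leaves a warden move d < c of remoteness m below two strictly faster moves
-- c and e.  Descending from γ d towards the slower of c and e reaches a
-- position with prefix γ and last symbol at most d whose prisoner could play
-- the faster one instead, contradicting its remoteness.  The argument is
-- classical, which is harmless because equality of strings is decidable.
module Submission where

open import Defs
open import Data.Nat using (ℕ; suc)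
open import Relation.Binary.PropositionalEquality using (_≡_)
open import Relation.Unary using (Pred)
open import Level using (0ℓ)

open import Data.Nat using (zero; _≤_; _<_; _≤′_; ≤′-refl; ≤′-step; z≤n; s≤s)
open import Data.Nat.Properties
  using (≤-refl; ≤-trans; <⇒≤; ≤-pred; m≤n⇒m≤1+n; <-≤-trans; <-cmp; ≮⇒≥; ≤⇒≤′)
open import Data.Nat.Induction using (<-rec)
open import Data.Fin as Fin using (Fin)
open import Data.Fin.Properties as Fin using (_≟_; <⇒≢)
open import Data.List as List using (List; _++_; [_]; length)
open import Data.List.Properties using (++-assoc; ++-identityʳ)
open import Data.Vec using (Vec; _∷_; _∷ʳ_; init; last; initLast; toList)
open import Data.Vec.Properties
  using (toList-∷ʳ; toList-injective; cast-is-id; length-toList; ∷-injectiveˡ; ∷-injectiveʳ; ≡-dec)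
open import Data.Product using (∃; _×_; _,_; proj₁; proj₂)
open import Data.Sum using (_⊎_; inj₁; inj₂)
open import Data.Empty using (⊥; ⊥-elim)
open import Function using (_∘_; id; case_of_)
open import Effect.Monad using (RawMonad)
open import Relation.Nullary using (¬_; yes; no)
open import Relation.Nullary.Decidable using (¬¬-excluded-middle; decidable-stable)
open import Relation.Nullary.Negation using (¬¬-Monad)
open import Relation.Binary.Definitions using (tri<; tri≈; tri>)
open import Relation.Binary.PropositionalEquality
  using (_≢_; refl; sym; trans; cong; cong₂; subst; ≢-sym; module ≡-Reasoning)

open RawMonad (¬¬-Monad {a = 0ℓ})

¬¬⊥⇒⊥ : ¬ ¬ ⊥ → ⊥
¬¬⊥⇒⊥ ¬¬⊥ = ¬¬⊥ id

¬¬-∀-Fin : ∀ {k} {P : Fin k → Set} → (∀ x → ¬ ¬ P x) → ¬ ¬ (∀ x → P x)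
¬¬-∀-Fin {zero}  _   ¬∀ = ¬∀ λ ()
¬¬-∀-Fin {suc k} ¬¬P ¬∀ =
  ¬¬P Fin.zero λ P₀ → ¬¬-∀-Fin (¬¬P ∘ Fin.suc) λ Pₛ →
    ¬∀ λ { Fin.zero → P₀ ; (Fin.suc x) → Pₛ x }

iterate : {A : Set} → (A → A) → ℕ → A → A
iterate f zero    x = x
iterate f (suc j) x = iterate f j (f x)

iterate-natural : {A B : Set} {f : A → A} {g : B → B} (h : A → B)
  → (∀ x → h (f x) ≡ g (h x)) → ∀ j x → h (iterate f j x) ≡ iterate g j (h x)
iterate-natural h comm zero    x = refl
iterate-natural {f = f} {g} h comm (suc j) x =
  trans (iterate-natural h comm j (f x)) (cong (iterate g j) (comm x))

module _ {A : Set} where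

  rotateᴸ : List A → List A
  rotateᴸ List.[]       = List.[]
  rotateᴸ (x List.∷ xs) = xs ++ [ x ]

  toList-rotate : ∀ {m} (v : Vec A m) → toList (rotate v) ≡ rotateᴸ (toList v)
  toList-rotate Vec.[]   = refl
  toList-rotate (x ∷ xs) = toList-∷ʳ x xs

  iterate-rotateᴸ-++ : (xs ys : List A) → iterate rotateᴸ (length xs) (xs ++ ys) ≡ ys ++ xs
  iterate-rotateᴸ-++ List.[]       ys = sym (++-identityʳ ys)
  iterate-rotateᴸ-++ (x List.∷ xs) ys = begin
    iterate rotateᴸ (length xs) ((xs ++ ys) ++ [ x ]) ≡⟨ cong (iterate rotateᴸ (length xs)) (++-assoc xs ys [ x ]) ⟩
    iterate rotateᴸ (length xs) (xs ++ ys ++ [ x ])   ≡⟨ iterate-rotateᴸ-++ xs (ys ++ [ x ]) ⟩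
    (ys ++ [ x ]) ++ xs                               ≡⟨ ++-assoc ys [ x ] xs ⟩
    ys ++ x List.∷ xs                                 ∎
    where open ≡-Reasoning

  iterate-rotate-∷ʳ : ∀ {n} (γ : Vec A n) (c : A) → iterate rotate n (γ ∷ʳ c) ≡ c ∷ γ
  iterate-rotate-∷ʳ {n} γ c =
    trans (sym (cast-is-id refl _)) (toList-injective refl _ _ (begin
      toList (iterate rotate n (γ ∷ʳ c))     ≡⟨ iterate-natural toList toList-rotate n (γ ∷ʳ c) ⟩
      iterate rotateᴸ n (toList (γ ∷ʳ c))    ≡⟨ cong (iterate rotateᴸ n) (toList-∷ʳ c γ) ⟩
      iterate rotateᴸ n (toList γ ++ [ c ])  ≡⟨ cong (λ j → iterate rotateᴸ j (toList γ ++ [ c ])) (sym (length-toList γ)) ⟩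
      iterate rotateᴸ (length (toList γ)) (toList γ ++ [ c ]) ≡⟨ iterate-rotateᴸ-++ (toList γ) [ c ] ⟩
      toList (c ∷ γ)                         ∎))
    where open ≡-Reasoning

  init-∷ʳ-last : ∀ {n} (v : Vec A (suc n)) → v ≡ init v ∷ʳ last v
  init-∷ʳ-last v = proj₂ (proj₂ (initLast v))

  init-last-injective : ∀ {n} {v w : Vec A (suc n)} → init v ≡ init w → last v ≡ last w → v ≡ w
  init-last-injective {v = v} {w} init≡ last≡ =
    trans (init-∷ʳ-last v) (trans (cong₂ _∷ʳ_ init≡ last≡) (sym (init-∷ʳ-last w)))

module _ {n k : ℕ} {S : Pred (T (suc n) k) 0ℓ} (closed : RotationClosed S) where

  iterate-rotate-closed : ∀ j v → S v → S (iterate rotate j v)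
  iterate-rotate-closed zero    v sv = sv
  iterate-rotate-closed (suc j) v sv = iterate-rotate-closed j (rotate v) (closed v sv)

  last∷init-closed : ∀ v → S v → S (last v ∷ init v)
  last∷init-closed v sv =
    subst S (iterate-rotate-∷ʳ (init v) (last v))
      (iterate-rotate-closed n _ (subst S (init-∷ʳ-last v) sv))

module UniqueRemoteness {n k : ℕ} (S : Pred (T (suc n) k) 0ℓ) (α : T (suc n) k)
                        (closed : RotationClosed S) where

  open WardensGame S α

  Position : Set
  Position = T (suc n) k

  Prefix : Set
  Prefix = Vec (Fin k) n

  WardenMovesGood : ℕ → Prefix → Fin k → Set
  WardenMovesGood t γ c = ∀ c' → c' Fin.< c → S (c' ∷ γ) → Good t (c' ∷ γ)

  PrisonerMoveGood : ℕ → Prefix → Fin k → Set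
  PrisonerMoveGood t γ c = ∃ λ c' → c Fin.≤ c' × S (c' ∷ γ) × Good t (c' ∷ γ)

  -- Forces (suc t) β unfolds to MovesGood t (init β) (last β).
  MovesGood : ℕ → Prefix → Fin k → Set
  MovesGood t γ c = WardenMovesGood t γ c × PrisonerMoveGood t γ c

  mutual
    Forces-suc : ∀ {t β} → Forces t β → Forces (suc t) β
    Forces-suc {suc t} (w , c' , c≤c' , s , g) =
      (λ x x<c sx → Good-suc (w x x<c sx)) , c' , c≤c' , s , Good-suc g

    Good-suc : ∀ {t δ} → Good t δ → Good (suc t) δ
    Good-suc (inj₁ δ≡α) = inj₁ δ≡α
    Good-suc (inj₂ f)   = inj₂ (Forces-suc f)

  Good-mono : ∀ {t t' δ} → t ≤ t' → Good t δ → Good t' δ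
  Good-mono = go ∘ ≤⇒≤′
    where
    go : ∀ {t t' δ} → t ≤′ t' → Good t δ → Good t' δ
    go ≤′-refl        g = g
    go (≤′-step t≤t') g = Good-suc (go t≤t' g)

  good-zero : ∀ {δ} → Good 0 δ → δ ≡ α
  good-zero (inj₁ δ≡α) = δ≡α

  -- The remoteness of δ as the target of a move: reaching α counts as 0 moves.
  Value : Position → ℕ → Set
  Value δ j = Good j δ × (∀ {t} → t < j → ¬ Good t δ)

  value-suc : ∀ {q δ} → Good (suc q) δ → ¬ Good q δ → Value δ (suc q)
  value-suc g ¬g = g , λ t<1+q g' → ¬g (Good-mono (≤-pred t<1+q) g')

  value-zero : ∀ {δ} → Value δ 0 → δ ≡ α
  value-zero = good-zero ∘ proj₁

  value⇒remoteness : ∀ {j δ} → Value δ (suc j) → Remoteness δ (suc j)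
  value⇒remoteness (inj₁ δ≡α , minimal) = ⊥-elim (minimal (s≤s z≤n) (inj₁ δ≡α))
  value⇒remoteness (inj₂ f   , minimal) = f , λ _ t<m f' → minimal t<m (inj₂ f')

  least-value : ∀ {t δ} → Good t δ → ¬ ¬ (∃ λ j → j ≤ t × Value δ j)
  least-value {zero}  g = pure (0 , z≤n , g , λ ())
  least-value {suc t} g = do
    yes g' ← ¬¬-excluded-middle
      where no ¬g → pure (suc t , ≤-refl , value-suc g ¬g)
    (j , j≤t , v) ← least-value g'
    pure (j , m≤n⇒m≤1+n j≤t , v)

  faster-or-value : ∀ {q δ} → Good (suc q) δ → ¬ ¬ (Good q δ ⊎ Value δ (suc q))
  faster-or-value g = do
    yes g' ← ¬¬-excluded-middle
      where no ¬g → pure (inj₂ (value-suc g ¬g))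
    pure (inj₁ g')

  warden-moves-good : ∀ {t γ c} → (∀ x → x Fin.< c → S (x ∷ γ) → ¬ ¬ Good t (x ∷ γ))
    → ¬ ¬ WardenMovesGood t γ c
  warden-moves-good good = ¬¬-∀-Fin λ x ¬ok →
    ¬ok λ x<c sx → ⊥-elim (good x x<c sx λ g → ¬ok λ _ _ → g)

  bad-warden-move : ∀ {t γ c} → ¬ WardenMovesGood t γ c
    → ¬ ¬ (∃ λ x → x Fin.< c × S (x ∷ γ) × ¬ Good t (x ∷ γ))
  bad-warden-move ¬w ¬bad = warden-moves-good (λ x x<c sx ¬g → ¬bad (x , x<c , sx , ¬g)) ¬w

  -- Either the prisoner's move or, by optimality, some warden move has value i.
  successor-value : ∀ {i β} → Remoteness β (suc i)
    → ¬ ¬ (∃ λ x → S (x ∷ init β) × Value (x ∷ init β) i)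
  successor-value {zero}   ((_ , x , _ , sx , gx) , _) = pure (x , sx , gx , λ ())
  successor-value {suc i} ((w , x , c≤x , sx , gx) , minimal) = do
    inj₁ gx' ← faster-or-value gx
      where inj₂ vx → pure (x , sx , vx)
    (d , d<c , sd , ¬gd) ← bad-warden-move λ w' → minimal (suc i) ≤-refl (w' , x , c≤x , sx , gx')
    pure (d , sd , value-suc (w d d<c sd) ¬gd)

  descend : ∀ {i j δ} → j ≤′ i → Value δ i → ¬ ¬ (∃ λ δ' → Value δ' j)
  descend ≤′-refl        v = pure (_ , v)
  descend (≤′-step j≤i) v = do
    (_ , _ , v') ← successor-value (value⇒remoteness v)
    descend j≤i v'

  distinct-moves : ∀ {γ : Prefix} {x y} → x Fin.< y → x ∷ γ ≢ y ∷ γ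
  distinct-moves x<y = <⇒≢ x<y ∘ ∷-injectiveˡ

  UniqueRemoteness : ℕ → Set
  UniqueRemoteness m = ∀ {β β'} → S β → S β' → Remoteness β m → Remoteness β' m → β ≡ β'

  UniqueValue : ℕ → Set
  UniqueValue j = ∀ {δ δ'} → S δ → S δ' → Value δ j → Value δ' j → δ ≡ δ'

  UniqueValuesUpTo : ℕ → Set
  UniqueValuesUpTo i = ∀ {j} → j ≤ i → UniqueValue j

  unique-value : ∀ {j} → UniqueRemoteness j → UniqueValue j
  unique-value {zero}  _ _ _  v v' = trans (value-zero v) (sym (value-zero v'))
  unique-value {suc j} u s s' v v' = u s s' (value⇒remoteness v) (value⇒remoteness v')

  faster-unless-equal : ∀ {q δ δ'} → UniqueValue (suc q) → S δ → S δ' → Value δ' (suc q)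
    → δ ≢ δ' → Good (suc q) δ → ¬ ¬ Good q δ
  faster-unless-equal unique s s' v' δ≢δ' g ¬g = δ≢δ' (unique s s' (value-suc g ¬g) v')

  warden-move-slower⇒last≤ : ∀ {j m ρ γ d} → Remoteness ρ (suc j) → init ρ ≡ γ
    → S (d ∷ γ) → Value (d ∷ γ) m → j < m → last ρ Fin.≤ d
  warden-move-slower⇒last≤ ((w , _) , _) refl sd (_ , minimal) j<m =
    ≮⇒≥ λ d<c → minimal j<m (w _ d<c sd)

  -- Only one move from ρ is as slow as the remainder, so if it lies above
  -- last ρ every warden move is faster.
  prisoner-cannot-beat : ∀ {q ρ γ a} → UniqueValue (suc q) → Remoteness ρ (suc (suc q))
    → init ρ ≡ γ → S (a ∷ γ) → Value (a ∷ γ) (suc q) → last ρ Fin.≤ a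
    → ¬ PrisonerMoveGood q γ (last ρ)
  prisoner-cannot-beat unique ((w , _) , minimal) refl sa va c≤a p =
    warden-moves-good
      (λ x x<c sx → faster-unless-equal unique sx sa va
                      (distinct-moves (<-≤-trans x<c c≤a)) (w x x<c sx))
      (λ w' → minimal _ ≤-refl (w' , p))

  descend-to-prefix : ∀ {i j γ d a} → j ≤ i → UniqueValue j
    → S (d ∷ γ) → Value (d ∷ γ) (suc i) → S (a ∷ γ) → Value (a ∷ γ) j
    → ¬ ¬ (∃ λ ρ → Remoteness ρ (suc j) × init ρ ≡ γ × last ρ Fin.≤ d)
  descend-to-prefix j≤i unique sd vd sa va = do
    (ρ , vρ) ← descend (≤⇒≤′ (s≤s j≤i)) vd
    let rρ = value⇒remoteness vρ
    (_ , sx , vx) ← successor-value rρ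
    let same-prefix = ∷-injectiveʳ (unique sx sa vx va)
    pure (ρ , rρ , same-prefix , warden-move-slower⇒last≤ rρ same-prefix sd vd (s≤s j≤i))

  slower-move-blocked : ∀ {i γ d a b ja jb} → UniqueValuesUpTo (suc i)
    → S (d ∷ γ) → Value (d ∷ γ) (suc i) → d Fin.< a → d Fin.< b
    → S (a ∷ γ) → Value (a ∷ γ) ja → ja ≤ i → S (b ∷ γ) → Value (b ∷ γ) jb → jb < ja → ⊥
  slower-move-blocked {ja = suc q} unique sd vd d<a d<b sa va ja≤i sb vb jb≤q = ¬¬⊥⇒⊥ do
    (ρ , rρ , same-prefix , c≤d) ← descend-to-prefix ja≤i (unique (m≤n⇒m≤1+n ja≤i)) sd vd sa va
    pure (prisoner-cannot-beat (unique (m≤n⇒m≤1+n ja≤i)) rρ same-prefix sa va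
            (≤-trans c≤d (<⇒≤ d<a))
            (_ , ≤-trans c≤d (<⇒≤ d<b) , sb , Good-mono (≤-pred jb≤q) (proj₁ vb)))

  two-fast-moves-above-value : ∀ {i γ d c e} → UniqueValuesUpTo (suc i)
    → S (d ∷ γ) → Value (d ∷ γ) (suc i) → d Fin.< c → d Fin.< e → c ≢ e
    → S (c ∷ γ) → Good i (c ∷ γ) → S (e ∷ γ) → Good i (e ∷ γ) → ⊥
  two-fast-moves-above-value unique sd vd d<c d<e c≢e sc gc se ge = ¬¬⊥⇒⊥ do
    (jc , jc≤i , vc) ← least-value gc
    (je , je≤i , ve) ← least-value ge
    pure (case <-cmp jc je of λ where
      (tri< jc<je _ _) → slower-move-blocked unique sd vd d<e d<c se ve je≤i sc vc jc<je
      (tri≈ _ refl _)  → c≢e (∷-injectiveˡ (unique (m≤n⇒m≤1+n jc≤i) sc se vc ve))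
      (tri> _ _ je<jc) → slower-move-blocked unique sd vd d<c d<e sc vc jc≤i se ve je<jc)

  smaller-last-impossible : ∀ {i β c'} → UniqueValuesUpTo i → S β → Remoteness β (suc i)
    → last β Fin.< c' → MovesGood i (init β) c' → ⊥
  smaller-last-impossible {zero} _ sβ _ c<c' (w' , e , c'≤e , se , ge) =
    distinct-moves (<-≤-trans c<c' c'≤e)
      (trans (good-zero (w' _ c<c' (last∷init-closed closed _ sβ))) (sym (good-zero ge)))
  smaller-last-impossible {suc i} {β} unique sβ rβ@(_ , minimal) c<c' (w' , e , c'≤e , se , ge) =
    ¬¬⊥⇒⊥ do
      inj₁ gc' ← faster-or-value gc
        where inj₂ vc → do
          ge' ← faster-unless-equal (unique ≤-refl) se sc vc (≢-sym (distinct-moves c<e)) ge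
          pure (prisoner-cannot-beat (unique ≤-refl) rβ refl sc vc ≤-refl (e , <⇒≤ c<e , se , ge'))
      (d , d<c , sd , ¬gd) ← bad-warden-move λ w → minimal (suc i) ≤-refl (w , _ , ≤-refl , sc , gc')
      let vd  = value-suc (w' d (Fin.<-trans d<c c<c') sd) ¬gd
          d<e = Fin.<-trans d<c c<e
      ge' ← faster-unless-equal (unique ≤-refl) se sd vd (≢-sym (distinct-moves d<e)) ge
      pure (two-fast-moves-above-value unique sd vd d<c d<e (<⇒≢ c<e) sc gc' se ge')
    where
    sc : S (last β ∷ init β)
    sc = last∷init-closed closed β sβ

    gc : Good (suc i) (last β ∷ init β)
    gc = w' _ c<c' sc

    c<e : last β Fin.< e
    c<e = <-≤-trans c<c' c'≤e

  unique-remoteness : ∀ m → UniqueRemoteness m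
  unique-remoteness = <-rec UniqueRemoteness step
    where
    step : ∀ m → (∀ {m'} → m' < m → UniqueRemoteness m') → UniqueRemoteness m
    step zero    _  _ _ (() , _) _
    step (suc i) ih {β} {β'} sβ sβ' rβ rβ' =
      decidable-stable (≡-dec _≟_ β β') λ β≢β' → ¬¬⊥⇒⊥ do
        (_ , sx , vx)  ← successor-value rβ
        (_ , sx' , vx') ← successor-value rβ'
        let same-prefix = ∷-injectiveʳ (unique ≤-refl sx sx' vx vx')
        pure (case Fin.<-cmp (last β) (last β') of λ where
          (tri< c<c' _ _) → smaller-last-impossible unique sβ rβ c<c'
                              (subst (λ γ → MovesGood i γ (last β')) (sym same-prefix) (proj₁ rβ'))
          (tri≈ _ c≡c' _) → β≢β' (init-last-injective same-prefix c≡c')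
          (tri> _ _ c'<c) → smaller-last-impossible unique sβ' rβ' c'<c
                              (subst (λ γ → MovesGood i γ (last β)) same-prefix (proj₁ rβ)))
      where
      unique : UniqueValuesUpTo i
      unique j≤i = unique-value (ih (s≤s j≤i))

mainTheorem6 : ∀ {n k : ℕ} (S : Pred (T (suc n) k) 0ℓ) (α : T (suc n) k)
    → RotationClosed S → S α
    → ∀ (m : ℕ) (β β′ : T (suc n) k) → S β → S β′
    → WardensGame.Remoteness S α β m → WardensGame.Remoteness S α β′ m
    → β ≡ β′
mainTheorem6 S α closed _ m _ _ = UniqueRemoteness.unique-remoteness S α closed m
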